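{- For every $\pi\in\mathcal I_n(321)$, we have $$\mathrm{Des}(\pi)=\mathrm{Peak}(\rho(\pi)).$$
   Context: $\mathcal I_n(321)$ is the set of involutions of $\{1,\dots,n\}$ avoiding the pattern $321$. $\mathrm{Des}(\pi)=\{i\in[n-1]:\pi(i)>\pi(i+1)\}$ is the descent set. The map $\rho$ sends $\pi\in\mathcal I_n(321)$ to a Dyck path prefix of length $n$ (lattice path with steps $N=(0,1)$, $E=(1,0)$ from the origin never going below $y=x$) as follows: applying the Robinson–Schensted algorithm to the involution $\pi$ yields a pair of identical standard Young tableaux $(Q,Q)$ with at most two rows; $\rho(\pi)$ is the path whose $i$-th step is $N$ if $i$ is in the first row of $Q$ and $E$ if $i$ is in the second row. $\mathrm{Peak}(P)$ is the set of labels (vertices labelled $0,\dots,n$ from the origin) of vertices in the middle of an occurrence of $NE$ in $P$. -}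

module Defs where

open import Data.Nat using (ℕ; zero; suc; _+_; _∸_; _≤_; _<_; _<ᵇ_; _≡ᵇ_)
open import Data.Bool using (Bool; true; false; if_then_else_)
open import Data.Fin using (Fin; toℕ)
import Data.Fin as F
open import Data.List using (List; []; _∷_; _++_; map; allFin; upTo)
open import Data.Bool.ListAction using (any)
open import Data.Maybe using (Maybe; just; nothing)
open import Data.Product using (Σ; ∃; _×_; _,_)
open import Relation.Binary.PropositionalEquality using (_≡_)

-- Permutations / involutions of [n] (positions and values as Fin n,
-- i.e. 0-indexed internally; the 1-indexed value of position j is toℕ j + 1).

IsInvolution : (n : ℕ) → (Fin n → Fin n) → Set
IsInvolution n π = ∀ i → π (π i) ≡ i

Avoids321 : (n : ℕ) → (Fin n → Fin n) → Set
Avoids321 n π = ∀ (i j k : Fin n) → i F.< j → j F.< k →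
  π j F.< π i → π k F.< π j → Data.Empty.⊥
  where import Data.Empty

-- Descent set, as a predicate on ℕ with 1-indexed positions:
-- i ∈ Des(π) iff 1 ≤ i ≤ n-1 and π(i) > π(i+1).
Des : (n : ℕ) → (Fin n → Fin n) → ℕ → Set
Des n π i = Σ (Fin n) λ a → Σ (Fin n) λ b →
  (toℕ a + 1 ≡ i) × (toℕ b ≡ i) × (π b F.< π a)

Tableau : Set
Tableau = List (List ℕ)

insertRow : ℕ → List ℕ → Maybe ℕ × List ℕ
insertRow x [] = nothing , (x ∷ [])
insertRow x (y ∷ ys) with x <ᵇ y
... | true  = just y , (x ∷ ys)
... | false with insertRow x ys
...   | (b , ys') = b , (y ∷ ys')

-- insert x into the tableau; also return the (0-indexed) row in which
-- the new box was created
insertT : ℕ → Tableau → Tableau × ℕ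
insertT x [] = ((x ∷ []) ∷ []) , 0
insertT x (r ∷ rs) with insertRow x r
... | (nothing , r') = (r' ∷ rs) , 0
... | (just y , r') with insertT y rs
...   | (rs' , k) = (r' ∷ rs') , suc k

addAt : ℕ → ℕ → Tableau → Tableau
addAt zero    v []       = (v ∷ []) ∷ []
addAt (suc k) v []       = (v ∷ []) ∷ []
addAt zero    v (r ∷ rs) = (r ++ (v ∷ [])) ∷ rs
addAt (suc k) v (r ∷ rs) = r ∷ addAt k v rs

-- RS on a word: t = label of the next letter, P insertion tableau,
-- Q recording tableau
rsGo : ℕ → List ℕ → Tableau → Tableau → Tableau × Tableau
rsGo t [] P Q = P , Q
rsGo t (x ∷ xs) P Q with insertT x P
... | (P' , k) = rsGo (suc t) xs P' (addAt k t Q)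

RS : List ℕ → Tableau × Tableau
RS w = rsGo 1 w [] []

word : (n : ℕ) → (Fin n → Fin n) → List ℕ
word n π = map (λ i → toℕ (π i) + 1) (allFin n)

recordingTableau : (n : ℕ) → (Fin n → Fin n) → Tableau
recordingTableau n π with RS (word n π)
... | (P , Q) = Q

firstRow : Tableau → List ℕ
firstRow [] = []
firstRow (r ∷ rs) = r

data Step : Set where
  N E : Step

Path : Set
Path = List Step

ρ : (n : ℕ) → (Fin n → Fin n) → Path
ρ n π = map (λ j → if any (λ x → x ≡ᵇ (j + 1)) (firstRow (recordingTableau n π))
                   then N else E)
            (upTo n)

at : {A : Set} → List A → ℕ → Maybe A
at [] _ = nothing
at (x ∷ xs) zero = just x
at (x ∷ xs) (suc k) = at xs k

-- Vertices are labelled 0..n; vertex i sits between step i and step i+1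
-- (steps 1-indexed). i ∈ Peak(P) iff step i is N and step i+1 is E.
Peak : Path → ℕ → Set
Peak P i = (1 ≤ i) × (at P (i ∸ 1) ≡ just N) × (at P i ≡ just E)

module Submission where

-- Write h for π on 0-indexed positions and call position j a
-- left-to-right maximum (LRmax) if h s ≤ h j for all s < j.  Both sides of
-- the theorem turn out to say that j is an LRmax while j+1 < n is not.
--
-- 1. Row insertion, for any word (Bump, insertRow-view, firstRow-rsGo):
--    the first row of the insertion tableau evolves by row insertion
--    alone, and the first row of the recording tableau lists exactly the
--    labels of the letters appended to that row instead of bumping.
-- 2. Left-to-right maxima of a 321-avoiding involution (module
--    LeftToRightMaxima): a position T that is not an LRmax has h T < T, so
--    its partner value T+1 was inserted earlier and is still in the first
--    row (invariant RowInv); hence the letter at T is appended exactly when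
--    T is an LRmax (recorded⇔LRmax).

open import Defs
open import Data.Nat using (ℕ)
open import Data.Fin using (Fin)
open import Function.Bundles using (_⇔_)

open import Data.Nat using (zero; suc; _+_; _≤_; _<_; _≡ᵇ_; _<ᵇ_; _<?_; z≤n; s≤s)
open import Data.Nat.Properties
open import Data.Fin using (toℕ; fromℕ<)
import Data.Fin as F
import Data.Fin.Properties as FinP
open import Data.Bool using (Bool; true; false; T; if_then_else_)
open import Data.Bool.ListAction using (any)
open import Data.List using (List; []; _∷_; _++_; map; applyUpTo; tabulate)
open import Data.List.Properties using (map-tabulate; ++-assoc; ++-identityʳ)
open import Data.List.Membership.Propositional using (_∈_)
open import Data.List.Membership.Propositional.Properties using (∈-++⁺ˡ; ∈-++⁺ʳ; ∈-++⁻)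
open import Data.List.Relation.Unary.All as All using (All; []; _∷_)
open import Data.List.Relation.Unary.AllPairs using (AllPairs; []; _∷_)
import Data.List.Relation.Unary.AllPairs.Properties as AllPairs
open import Data.List.Relation.Unary.Any as Any using (here; there)
open import Data.List.Relation.Unary.Any.Properties using (any⁺; any⁻)
open import Data.Maybe using (Maybe; just; nothing)
open import Data.Maybe.Properties using (just-injective)
open import Data.Product using (Σ; _×_; _,_; proj₂)
open import Data.Sum using (_⊎_; inj₁; inj₂; map₂)
open import Data.Empty using (⊥; ⊥-elim)
open import Relation.Binary.PropositionalEquality
open import Relation.Binary.Definitions using (tri<; tri≈; tri>)
open import Relation.Nullary using (¬_; yes; no)
open import Function.Bundles using (mk⇔; Equivalence)
open import Function.Construct.Composition using (_⇔-∘_)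
open import Function.Construct.Symmetry using (⇔-sym)

Sorted : List ℕ → Set
Sorted = AllPairs _≤_

record Bump (x : ℕ) (r : List ℕ) (y : ℕ) (r' : List ℕ) : Set where
  field
    bumped∈    : y ∈ r
    x<y        : x < y
    leastAbove : Sorted r → ∀ {z} → z ∈ r → x < z → y ≤ z
    lost       : ∀ {z} → z ∈ r → z ≡ y ⊎ z ∈ r'
    gained     : ∀ {z} → z ∈ r' → z ≡ x ⊎ z ∈ r
    inserted∈  : x ∈ r'
    sorted     : Sorted r → Sorted r'

headBump : ∀ {x y ys} → x < y → Bump x (y ∷ ys) y (x ∷ ys)
headBump {x} {y} {ys} x<y = record
  { bumped∈ = here refl ; x<y = x<y ; leastAbove = leastAbove
  ; lost = λ { (here e) → inj₁ e ; (there p) → inj₂ (there p) }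
  ; gained = λ { (here e) → inj₁ e ; (there p) → inj₂ (there p) }
  ; inserted∈ = here refl
  ; sorted = λ { (y≤ys ∷ s) → All.map (≤-trans (<⇒≤ x<y)) y≤ys ∷ s } }
  where
  leastAbove : Sorted (y ∷ ys) → ∀ {z} → z ∈ y ∷ ys → x < z → y ≤ z
  leastAbove _           (here refl) _ = ≤-refl
  leastAbove (y≤ys ∷ _) (there p)   _ = All.lookup y≤ys p

consBump : ∀ {x y ys b r'} → y ≤ x → Bump x ys b r' → Bump x (y ∷ ys) b (y ∷ r')
consBump {x} {y} {ys} {b} {r'} y≤x B = record
  { bumped∈ = there bumped∈ ; x<y = x<y ; leastAbove = leastAbove'
  ; lost = λ { (here e) → inj₂ (here e) ; (there p) → map₂ there (lost p) }
  ; gained = λ { (here e) → inj₂ (here e) ; (there p) → map₂ there (gained p) }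
  ; inserted∈ = there inserted∈
  ; sorted = λ { (y≤ys ∷ s) → All.tabulate (y≤r' y≤ys) ∷ sorted s } }
  where
  open Bump B
  leastAbove' : Sorted (y ∷ ys) → ∀ {z} → z ∈ y ∷ ys → x < z → b ≤ z
  leastAbove' _       (here refl) x<z = ⊥-elim (<⇒≱ x<z y≤x)
  leastAbove' (_ ∷ s) (there p)   x<z = leastAbove s p x<z
  y≤r' : All (y ≤_) ys → ∀ {z} → z ∈ r' → y ≤ z
  y≤r' y≤ys p with gained p
  ... | inj₁ refl = y≤x
  ... | inj₂ q    = All.lookup y≤ys q

≮ᵇ⇒≥ : ∀ {x y} → (x <ᵇ y) ≡ false → y ≤ x
≮ᵇ⇒≥ {x} {y} x≮ᵇy = ≮⇒≥ (λ x<y → subst T x≮ᵇy (<⇒<ᵇ x<y))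

data RowInsertion (x : ℕ) (r : List ℕ) : Maybe ℕ × List ℕ → Set where
  appended : All (_≤ x) r → RowInsertion x r (nothing , r ++ x ∷ [])
  bumped   : ∀ {y r'} → Bump x r y r' → RowInsertion x r (just y , r')

insertRow-view : ∀ x r → RowInsertion x r (insertRow x r)
insertRow-view x [] = appended []
insertRow-view x (y ∷ ys) with x <ᵇ y in x<ᵇy
... | true  = bumped (headBump (<ᵇ⇒< x y (subst T (sym x<ᵇy) _)))
... | false with insertRow x ys | insertRow-view x ys
...   | _ | appended ys≤x = appended (≮ᵇ⇒≥ x<ᵇy ∷ ys≤x)
...   | _ | bumped B      = bumped (consBump (≮ᵇ⇒≥ x<ᵇy) B)

∈-tail⇔ : ∀ {A : Set} {a b : A} {xs} → a ≢ b → (a ∈ b ∷ xs) ⇔ (a ∈ xs)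
∈-tail⇔ a≢b = mk⇔ (λ { (here e) → ⊥-elim (a≢b e) ; (there p) → p }) there

appendedLabels : ℕ → List ℕ → List ℕ → List ℕ
appendedLabels t []       r = []
appendedLabels t (x ∷ xs) r with insertRow x r
... | nothing , r' = t ∷ appendedLabels (suc t) xs r'
... | just _  , r' = appendedLabels (suc t) xs r'

appendedLabels-≥ : ∀ t w r {z} → z ∈ appendedLabels t w r → t ≤ z
appendedLabels-≥ t (x ∷ xs) r p with insertRow x r
... | nothing , r' with p
...   | here refl = ≤-refl
...   | there q   = <⇒≤ (appendedLabels-≥ (suc t) xs r' q)
appendedLabels-≥ t (x ∷ xs) r p | just _ , r' =
  <⇒≤ (appendedLabels-≥ (suc t) xs r' p)

-- The first row of the recording tableau only grows when a letter is
-- appended to the first row of the insertion tableau.  (The hypothesis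
-- says P is empty until something has been recorded.)
firstRow-rsGo : ∀ t w P Q → (Q ≡ [] → P ≡ []) →
  firstRow (proj₂ (rsGo t w P Q)) ≡ firstRow Q ++ appendedLabels t w (firstRow P)
firstRow-rsGo t [] P Q _ = sym (++-identityʳ (firstRow Q))
firstRow-rsGo t (x ∷ xs) [] [] _ = firstRow-rsGo (suc t) xs _ _ (λ ())
firstRow-rsGo t (x ∷ xs) [] (q ∷ qs) _ = trans (firstRow-rsGo (suc t) xs _ _ (λ ())) (++-assoc q _ _)
firstRow-rsGo t (x ∷ xs) (r ∷ rs) [] empty with () ← empty refl
firstRow-rsGo t (x ∷ xs) (r ∷ rs) (q ∷ qs) _ with insertRow x r
... | nothing , r' = trans (firstRow-rsGo (suc t) xs _ _ (λ ())) (++-assoc q _ _)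
... | just y  , r' with insertT y rs
...   | rs' , k = firstRow-rsGo (suc t) xs _ _ (λ ())

module LeftToRightMaxima (n : ℕ) (h : ℕ → ℕ)
  (h<n : ∀ {m} → m < n → h m < n)
  (involutive : ∀ {m} → m < n → h (h m) ≡ m)
  (avoids321 : ∀ {i j k} → i < j → j < k → k < n → h j < h i → h k < h j → ⊥)
  where

  LRmax : ℕ → Set
  LRmax j = ∀ s → s < j → h s ≤ h j

  -- A position dominated by an earlier value lies strictly below the
  -- diagonal; otherwise s, T and h s (resp. h T) would form a 321.
  dominated⇒below : ∀ {s T} → T < n → s < T → h T < h s → h T < T
  dominated⇒below {s} {T} T<n s<T hT<hs with <-cmp (h T) T
  ... | tri< hT<T _ _ = hT<T
  ... | tri≈ _ hT≡T _ = ⊥-elim (avoids321 s<T (subst (_< h s) hT≡T hT<hs) (h<n s<n) hT<hs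
                           (subst₂ _<_ (sym (involutive s<n)) (sym hT≡T) s<T))
    where s<n = <-trans s<T T<n
  ... | tri> _ _ T<hT = ⊥-elim (avoids321 s<T T<hT (h<n T<n) hT<hs
                           (subst (_< h T) (sym (involutive T<n)) T<hT))

  -- j+1 is a descent iff j is an LRmax and j+1 is not; the forward
  -- direction uses 321-avoidance.
  descent⇔ : ∀ {j} → suc j < n → h (suc j) < h j ⇔ (LRmax j × ¬ LRmax (suc j))
  descent⇔ {j} sj<n = mk⇔ to from
    where
    to : h (suc j) < h j → LRmax j × ¬ LRmax (suc j)
    to hsj<hj = (λ s s<j → ≮⇒≥ λ hj<hs → avoids321 s<j (n<1+n j) sj<n hj<hs hsj<hj)
              , λ lrmax → <⇒≱ hsj<hj (lrmax j (n<1+n j))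
    from : LRmax j × ¬ LRmax (suc j) → h (suc j) < h j
    from (lrmax , not-lrmax) = ≰⇒> λ hj≤hsj →
      not-lrmax λ s s<sj → below (m<1+n⇒m<n∨m≡n s<sj) hj≤hsj
      where
      below : ∀ {s} → s < j ⊎ s ≡ j → h j ≤ h (suc j) → h s ≤ h (suc j)
      below (inj₁ s<j) hj≤hsj = ≤-trans (lrmax _ s<j) hj≤hsj
      below (inj₂ refl) hj≤hsj = hj≤hsj

  -- The first row after inserting the values of positions 0,…,T-1
  -- (shifted to 1-indexed values): sorted, made of earlier values, and
  -- still holding every value h s + 1 whose partner position h s is ≥ T.
  record RowInv (T : ℕ) (r : List ℕ) : Set where
    field
      sorted  : Sorted r
      earlier : ∀ {z} → z ∈ r → Σ ℕ λ s → s < T × z ≡ h s + 1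
      pending : ∀ {s} → s < T → T ≤ h s → h s + 1 ∈ r

  rowInv-start : RowInv 0 []
  rowInv-start = record { sorted = [] ; earlier = λ () ; pending = λ () }

  module _ {T r} (I : RowInv T r) (T<n : T < n) where
    open RowInv I

    partner∈ : h T < T → T + 1 ∈ r
    partner∈ hT<T = subst (λ v → v + 1 ∈ r) (involutive T<n)
                      (pending hT<T (≤-reflexive (sym (involutive T<n))))

    appended⇒LRmax : All (_≤ h T + 1) r → LRmax T
    appended⇒LRmax r≤x s s<T = ≮⇒≥ λ hT<hs →
      let hT<T = dominated⇒below T<n s<T hT<hs
      in <⇒≱ hT<T (+-cancelʳ-≤ 1 T (h T) (All.lookup r≤x (partner∈ hT<T)))

    bumped⇒dominated : ∀ {y r'} → Bump (h T + 1) r y r' → Σ ℕ λ s → s < T × h T < h s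
    bumped⇒dominated B with earlier (Bump.bumped∈ B)
    ... | s , s<T , refl = s , s<T , +-cancelʳ-< 1 (h T) (h s) (Bump.x<y B)

    rowInv-append : All (_≤ h T + 1) r → RowInv (suc T) (r ++ h T + 1 ∷ [])
    rowInv-append r≤x = record
      { sorted = AllPairs.++⁺ sorted (All.[] ∷ []) (All.map (_∷ []) r≤x)
      ; earlier = earlier'
      ; pending = pending' }
      where
      earlier' : ∀ {z} → z ∈ r ++ h T + 1 ∷ [] → Σ ℕ λ s → s < suc T × z ≡ h s + 1
      earlier' p with ∈-++⁻ r p
      ... | inj₁ q with earlier q
      ...   | s , s<T , e = s , m≤n⇒m≤1+n s<T , e
      earlier' p | inj₂ (here e) = T , ≤-refl , e
      pending' : ∀ {s} → s < suc T → suc T ≤ h s → h s + 1 ∈ r ++ h T + 1 ∷ []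
      pending' s<sT sT≤hs with m<1+n⇒m<n∨m≡n s<sT
      ... | inj₁ s<T = ∈-++⁺ˡ (pending s<T (<⇒≤ sT≤hs))
      ... | inj₂ refl = ∈-++⁺ʳ r (here refl)

    -- A bumped entry is never a pending value: the pending values above
    -- h T + 1 are ≥ T+2, while the bumped entry is at most the partner T+1.
    rowInv-bump : ∀ {y r'} → Bump (h T + 1) r y r' → RowInv (suc T) r'
    rowInv-bump {y} {r'} B = record
      { sorted = Bump.sorted B sorted ; earlier = earlier' ; pending = pending' }
      where
      earlier' : ∀ {z} → z ∈ r' → Σ ℕ λ s → s < suc T × z ≡ h s + 1
      earlier' p with Bump.gained B p
      ... | inj₁ e = T , ≤-refl , e
      ... | inj₂ q with earlier q
      ...   | s , s<T , e = s , m≤n⇒m≤1+n s<T , e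
      y≤T+1 : y ≤ T + 1
      y≤T+1 with bumped⇒dominated B
      ... | s , s<T , hT<hs =
        let hT<T = dominated⇒below T<n s<T hT<hs
        in Bump.leastAbove B sorted (partner∈ hT<T) (+-monoˡ-< 1 hT<T)
      pending' : ∀ {s} → s < suc T → suc T ≤ h s → h s + 1 ∈ r'
      pending' s<sT sT≤hs with m<1+n⇒m<n∨m≡n s<sT
      ... | inj₂ refl = Bump.inserted∈ B
      ... | inj₁ s<T with Bump.lost B (pending s<T (<⇒≤ sT≤hs))
      ...   | inj₂ q = q
      ...   | inj₁ refl = ⊥-elim (<⇒≱ (+-monoˡ-< 1 sT≤hs) y≤T+1)

  letters : ℕ → ℕ → List ℕ
  letters T zero    = []
  letters T (suc k) = (h T + 1) ∷ letters (suc T) k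

  recorded⇔LRmax : ∀ k {T r} → T + k ≡ n → RowInv T r → ∀ {j} → T ≤ j → j < n →
    suc j ∈ appendedLabels (suc T) (letters T k) r ⇔ LRmax j
  recorded⇔LRmax zero {T} T≡n _ T≤j j<n =
    ⊥-elim (<⇒≱ j<n (subst (_≤ _) (trans (sym (+-identityʳ T)) T≡n) T≤j))
  recorded⇔LRmax (suc k) {T} {r} T+k≡n I {j} T≤j j<n
    with insertRow (h T + 1) r | insertRow-view (h T + 1) r | m≤n⇒m<n∨m≡n T≤j
  ... | _ | appended r≤x | inj₂ refl =
    mk⇔ (λ _ → appended⇒LRmax I j<n r≤x) (λ _ → here refl)
  ... | _ | appended r≤x | inj₁ T<j =
    recorded⇔LRmax k (trans (sym (+-suc T k)) T+k≡n) (rowInv-append I (≤-<-trans T≤j j<n) r≤x) T<j j<n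
      ⇔-∘ ∈-tail⇔ (λ sj≡sT → <⇒≢ T<j (sym (suc-injective sj≡sT)))
  ... | _ | bumped B | inj₂ refl = mk⇔
    (λ p → ⊥-elim (<⇒≱ (n<1+n (suc T)) (appendedLabels-≥ (suc (suc T)) (letters (suc T) k) _ p)))
    (λ lrmax → let (s , s<T , hT<hs) = bumped⇒dominated I j<n B in ⊥-elim (<⇒≱ hT<hs (lrmax s s<T)))
  ... | _ | bumped B | inj₁ T<j =
    recorded⇔LRmax k (trans (sym (+-suc T k)) T+k≡n) (rowInv-bump I (≤-<-trans T≤j j<n) B) T<j j<n

-- Extending a function on Fin n to ℕ (by 0 beyond n), so that positions
-- can be handled as natural numbers.
extend : ∀ {n} → (Fin n → ℕ) → ℕ → ℕ
extend {zero}  g _       = 0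
extend {suc n} g zero    = g F.zero
extend {suc n} g (suc m) = extend (λ i → g (F.suc i)) m

extend-toℕ : ∀ {n} (g : Fin n → ℕ) (i : Fin n) → extend g (toℕ i) ≡ g i
extend-toℕ g F.zero    = refl
extend-toℕ g (F.suc i) = extend-toℕ (λ i → g (F.suc i)) i

asFin : ∀ {n m} → m < n → Σ (Fin n) λ i → toℕ i ≡ m
asFin m<n = fromℕ< m<n , FinP.toℕ-fromℕ< m<n

at-map-applyUpTo : ∀ {A : Set} (f : ℕ → A) (g : ℕ → ℕ) k {i} → i < k →
  at (map f (applyUpTo g k)) i ≡ just (f (g i))
at-map-applyUpTo f g (suc k) {zero}  _         = refl
at-map-applyUpTo f g (suc k) {suc i} (s≤s i<k) = at-map-applyUpTo f (λ m → g (suc m)) k i<k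

at-map-applyUpTo-beyond : ∀ {A : Set} (f : ℕ → A) (g : ℕ → ℕ) k {i} → k ≤ i →
  at (map f (applyUpTo g k)) i ≡ nothing
at-map-applyUpTo-beyond f g zero    _         = refl
at-map-applyUpTo-beyond f g (suc k) (s≤s k≤i) = at-map-applyUpTo-beyond f (λ m → g (suc m)) k k≤i

∈⇔any : ∀ c xs → c ∈ xs ⇔ T (any (λ x → x ≡ᵇ c) xs)
∈⇔any c xs = mk⇔
  (λ c∈xs → any⁺ _ (Any.map (λ {x} c≡x → ≡⇒≡ᵇ x c (sym c≡x)) c∈xs))
  (λ found → Any.map (λ {x} t → sym (≡ᵇ⇒≡ x c t)) (any⁻ _ xs found))

stepOf : Bool → Step
stepOf b = if b then N else E

stepOf≡N : ∀ b → stepOf b ≡ N ⇔ T b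
stepOf≡N true  = mk⇔ _ (λ _ → refl)
stepOf≡N false = mk⇔ (λ ()) (λ ())

stepOf≡E : ∀ b → stepOf b ≡ E ⇔ (¬ T b)
stepOf≡E true  = mk⇔ (λ ()) (λ ¬t → ⊥-elim (¬t _))
stepOf≡E false = mk⇔ (λ _ ()) (λ _ → refl)

nothing≢just : ∀ {A : Set} {a : A} → nothing ≢ just a
nothing≢just ()

module Involution321 (n : ℕ) (π : Fin n → Fin n)
  (inv : IsInvolution n π) (av : Avoids321 n π) where

  h : ℕ → ℕ
  h = extend (λ i → toℕ (π i))

  h-toℕ : ∀ i → h (toℕ i) ≡ toℕ (π i)
  h-toℕ = extend-toℕ (λ i → toℕ (π i))

  h<n : ∀ {m} → m < n → h m < n
  h<n m<n with asFin m<n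
  ... | i , refl = subst (_< n) (sym (h-toℕ i)) (FinP.toℕ<n (π i))

  involutive : ∀ {m} → m < n → h (h m) ≡ m
  involutive m<n with asFin m<n
  ... | i , refl = begin
    h (h (toℕ i))     ≡⟨ cong h (h-toℕ i) ⟩
    h (toℕ (π i))     ≡⟨ h-toℕ (π i) ⟩
    toℕ (π (π i))     ≡⟨ cong toℕ (inv i) ⟩
    toℕ i             ∎
    where open ≡-Reasoning

  avoids321 : ∀ {i j k} → i < j → j < k → k < n → h j < h i → h k < h j → ⊥
  avoids321 i<j j<k k<n hj<hi hk<hj
    with asFin (<-trans i<j (<-trans j<k k<n)) | asFin (<-trans j<k k<n) | asFin k<n
  ... | a , refl | b , refl | c , refl =
    av a b c i<j j<k (subst₂ _<_ (h-toℕ b) (h-toℕ a) hj<hi) (subst₂ _<_ (h-toℕ c) (h-toℕ b) hk<hj)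

  open LeftToRightMaxima n h h<n involutive avoids321

  word≡letters : word n π ≡ letters 0 n
  word≡letters = trans (map-tabulate (λ i → i) (λ i → toℕ (π i) + 1))
                       (tabulate≡letters n 0 (λ i → cong (_+ 1) (sym (h-toℕ i))))
    where
    tabulate≡letters : ∀ k T {g : Fin k → ℕ} → (∀ i → g i ≡ h (T + toℕ i) + 1) →
      tabulate g ≡ letters T k
    tabulate≡letters zero    T g≡ = refl
    tabulate≡letters (suc k) T g≡ = cong₂ _∷_
      (trans (g≡ F.zero) (cong (λ m → h m + 1) (+-identityʳ T)))
      (tabulate≡letters k (suc T) λ i → trans (g≡ (F.suc i)) (cong (λ m → h m + 1) (+-suc T (toℕ i))))

  Q : Tableau
  Q = recordingTableau n π

  recorded : ∀ {j} → j < n → (j + 1) ∈ firstRow Q ⇔ LRmax j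
  recorded {j} j<n = mk⇔
    (λ j+1∈ → to (subst₂ _∈_ (+-comm j 1) Q-firstRow j+1∈))
    (λ lrmax → subst₂ _∈_ (+-comm 1 j) (sym Q-firstRow) (from lrmax))
    where
    open Equivalence (recorded⇔LRmax n (+-identityˡ n) rowInv-start z≤n j<n)
    Q-firstRow : firstRow Q ≡ appendedLabels 1 (letters 0 n) []
    Q-firstRow = trans (firstRow-rsGo 1 (word n π) [] [] (λ _ → refl))
                       (cong (λ w → appendedLabels 1 w []) word≡letters)

  inFirstRow : ℕ → Bool
  inFirstRow j = any (λ x → x ≡ᵇ (j + 1)) (firstRow Q)

  chosen⇔LRmax : ∀ {j} → j < n → T (inFirstRow j) ⇔ LRmax j
  chosen⇔LRmax j<n = recorded j<n ⇔-∘ ⇔-sym (∈⇔any _ _)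

  step : ℕ → Step
  step j = stepOf (inFirstRow j)

  ρ-at : ∀ {j s} → j < n → at (ρ n π) j ≡ just s ⇔ step j ≡ s
  ρ-at {j} j<n = mk⇔ (λ e → just-injective (trans (sym at≡) e)) (λ e → trans at≡ (cong just e))
    where
    at≡ : at (ρ n π) j ≡ just (step j)
    at≡ = at-map-applyUpTo step (λ m → m) n j<n

  ρ-defined : ∀ {j s} → at (ρ n π) j ≡ just s → j < n
  ρ-defined {j} e with j <? n
  ... | yes j<n = j<n
  ... | no  j≮n = ⊥-elim (nothing≢just (trans (sym beyond) e))
    where
    beyond : at (ρ n π) j ≡ nothing
    beyond = at-map-applyUpTo-beyond step (λ m → m) n (≮⇒≥ j≮n)

  stepN⇔ : ∀ {j} → j < n → at (ρ n π) j ≡ just N ⇔ LRmax j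
  stepN⇔ j<n = chosen⇔LRmax j<n ⇔-∘ (stepOf≡N _ ⇔-∘ ρ-at j<n)

  stepE⇔ : ∀ {j} → at (ρ n π) j ≡ just E ⇔ (j < n × ¬ LRmax j)
  stepE⇔ {j} = mk⇔
    (λ e → let j<n = ρ-defined e in
      j<n , λ lrmax → Equivalence.to (stepOf≡E _ ⇔-∘ ρ-at j<n) e
                        (Equivalence.from (chosen⇔LRmax j<n) lrmax))
    (λ (j<n , not-lrmax) → Equivalence.from (stepOf≡E _ ⇔-∘ ρ-at j<n)
      (λ t → not-lrmax (Equivalence.to (chosen⇔LRmax j<n) t)))

  peak⇔ : ∀ j → Peak (ρ n π) (suc j) ⇔ (suc j < n × LRmax j × ¬ LRmax (suc j))
  peak⇔ j = mk⇔
    (λ (_ , stepN , stepE) → let (sj<n , not-lrmax) = Equivalence.to stepE⇔ stepE in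
      sj<n , Equivalence.to (stepN⇔ (<-trans (n<1+n j) sj<n)) stepN , not-lrmax)
    (λ (sj<n , lrmax , not-lrmax) →
      s≤s z≤n , Equivalence.from (stepN⇔ (<-trans (n<1+n j) sj<n)) lrmax
              , Equivalence.from stepE⇔ (sj<n , not-lrmax))

  des⇔ : ∀ j → Des n π (suc j) ⇔ (suc j < n × LRmax j × ¬ LRmax (suc j))
  des⇔ j = mk⇔
    (λ (a , b , a+1≡sj , b≡sj , πb<πa) →
      let sj<n = subst (_< n) b≡sj (FinP.toℕ<n b)
          a≡j  = suc-injective (trans (+-comm 1 (toℕ a)) a+1≡sj)
      in sj<n , Equivalence.to (descent⇔ sj<n)
           (subst₂ _<_ (trans (sym (h-toℕ b)) (cong h b≡sj)) (trans (sym (h-toℕ a)) (cong h a≡j)) πb<πa))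
    (λ (sj<n , maxima) → from sj<n (Equivalence.from (descent⇔ sj<n) maxima))
    where
    from : suc j < n → h (suc j) < h j → Des n π (suc j)
    from sj<n hsj<hj with asFin (<-trans (n<1+n j) sj<n) | asFin sj<n
    ... | a , refl | b , b≡sj =
      a , b , +-comm (toℕ a) 1 , b≡sj
        , subst₂ _<_ (trans (cong h (sym b≡sj)) (h-toℕ b)) (h-toℕ a) hsj<hj

lemma3p1 : (n : ℕ) (π : Fin n → Fin n) → IsInvolution n π → Avoids321 n π →
    ∀ (i : ℕ) → Des n π i ⇔ Peak (ρ n π) i
lemma3p1 n π inv av zero = mk⇔
  (λ (a , _ , a+1≡0 , _) → ⊥-elim (1+n≢0 (trans (+-comm 1 (toℕ a)) a+1≡0)))
  (λ { (() , _) })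
lemma3p1 n π inv av (suc j) = ⇔-sym (peak⇔ j) ⇔-∘ des⇔ j
  where open Involution321 n π inv av
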